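{- Let $G=(V,A)$ be a directed graph with source $s\in V$ and arc-length function $l:A\to\mathbb{R}$, and suppose $G$ contains no negative-length cycle. Run the ZDO algorithm (described in the context) on $(G,s,l)$. Then in each round of the algorithm at least one vertex is scanned for the last time during that round.
   Context: Label-correcting setting: every vertex $v$ carries a potential $d(v)$ and a parent pointer $p(v)$; initially $d(s)=0$ and $d(v)=\infty$, $p(v)=\mathrm{nil}$ for $v\neq s$. The parent pointers define the parent graph $G_p$. For an arc $(u,v)$ the reduced cost is $l_d(u,v)=l(u,v)+d(u)-d(v)$; the arc is relaxable if $l_d(u,v)<0$, and the relaxable graph $G'_d$ consists of all vertices and all currently relaxable arcs. Scanning a vertex $u$ means: for every outgoing arc $(u,v)$ with $d(u)+l(u,v)<d(v)$, relax it by setting $d(v)\leftarrow d(u)+l(u,v)$ and $p(v)\leftarrow u$. A vertex is touched in a round if its potential was decreased during that round and it has not been scanned afterwards. ZDO algorithm: set $T=\{s\}$; while $T\neq\emptyset$, perform a round: for each vertex $v\in T$ (still on the round's list), if no incoming arc of $v$ is relaxable (in-degree zero in the current relaxable graph), scan $v$; then let $T$ be the set of vertices touched in this round. Subtree disassembly: whenever an arc $(u,v)$ is relaxed, all vertices of the subtree of $v$ in $G_p$ are dropped from the list of vertices to be scanned in the current round. The successive iterations of the while loop are the rounds.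
   Formalization: The arc-length function $l$ takes values in ℚ instead of ℝ. -}

module Defs where

open import Data.Nat using (ℕ; zero; suc; _<_)
open import Data.Fin using (Fin)
open import Data.Fin.Properties using (_≟_)
open import Data.Rational using (ℚ; 0ℚ; _+_; _≤_) renaming (_<_ to _<ℚ_)
open import Data.Rational.Properties using (_<?_)
open import Data.Bool using (Bool; true; false; if_then_else_; _∨_; _∧_; not)
open import Data.Maybe using (Maybe; just; nothing)
open import Data.Product using (_×_; _,_; proj₁; proj₂; ∃)
open import Data.List using (List; []; _∷_; foldr; foldl; filter; _++_)
open import Data.Bool.ListAction using (any)
open import Data.List.Relation.Unary.All using (All)
open import Data.List.Membership.Propositional using (_∈_)
open import Relation.Nullary using (does; ¬_)
open import Relation.Binary.PropositionalEquality using (_≡_; _≢_)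

-- Graphs: vertices Fin n, arcs (tail , head , length), a list (multigraph
-- allowed).  Lengths are rationals.

Arc : ℕ → Set
Arc n = Fin n × Fin n × ℚ

tl : ∀ {n} → Arc n → Fin n
tl (u , _ , _) = u

hd : ∀ {n} → Arc n → Fin n
hd (_ , v , _) = v

len : ∀ {n} → Arc n → ℚ
len (_ , _ , x) = x

data Chain {n : ℕ} : Fin n → List (Arc n) → Fin n → Set where
  stop : ∀ {u} → Chain u [] u
  step : ∀ {u v} (a : Arc n) {w} → tl a ≡ u → Chain (hd a) w v → Chain u (a ∷ w) v

walkLength : ∀ {n} → List (Arc n) → ℚ
walkLength = foldr (λ a r → len a + r) 0ℚ

NoNegativeCycle : ∀ {n} → List (Arc n) → Set
NoNegativeCycle {n} arcs =
  ∀ (u : Fin n) (w : List (Arc n)) → w ≢ [] → All (_∈ arcs) w →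
  Chain u w u → 0ℚ ≤ walkLength w

-- Potentials: nothing = ∞

Pot : Set
Pot = Maybe ℚ

improves : Pot → ℚ → Pot → Bool
improves nothing  l _        = false
improves (just x) l nothing  = true
improves (just x) l (just y) = does ((x + l) <? y)

eqF : ∀ {n} → Fin n → Fin n → Bool
eqF a b = does (a ≟ b)

record Config (n : ℕ) : Set where
  constructor config
  field
    pot    : Fin n → Pot
    parent : Fin n → Maybe (Fin n)
    T      : List (Fin n)          -- vertices to be scanned in the next round
open Config public

record RoundState (n : ℕ) : Set where
  constructor rstate
  field
    rpot     : Fin n → Pot
    rparent  : Fin n → Maybe (Fin n)
    dropped  : Fin n → Bool        -- removed from this round's list
    touched  : Fin n → Bool        -- decreased in this round, not scanned since
    scanned  : List (Fin n)
open RoundState public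

update : ∀ {n} {A : Set} → (Fin n → A) → Fin n → A → Fin n → A
update f v x w = if eqF w v then x else f w

-- w lies in the subtree of v in the parent graph G_p
-- (v reachable from w by following at most k parent pointers)
inSubtreeWithin : ∀ {n} → ℕ → (Fin n → Maybe (Fin n)) → Fin n → Fin n → Bool
inSubtreeWithin zero    p v w = eqF w v
inSubtreeWithin (suc k) p v w with eqF w v | p w
... | true  | _       = true
... | false | nothing = false
... | false | just x  = inSubtreeWithin k p v x

inSubtree : ∀ {n} → (Fin n → Maybe (Fin n)) → Fin n → Fin n → Bool
inSubtree {n} = inSubtreeWithin n

-- relax arc a = (u , v , l) (assumed relaxable): subtree disassembly of v,
-- then d(v) ← d(u)+l, p(v) ← u; v becomes touched
relaxArc : ∀ {n} → Arc n → RoundState n → RoundState n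
relaxArc (u , v , l) (rstate d p dr to sc) with d u
... | nothing = rstate d p dr to sc
... | just x  =
  rstate (update d v (just (x + l)))
         (update p v (just u))
         (λ w → dr w ∨ inSubtree p v w)
         (update to v true)
         sc

scanArc : ∀ {n} → Fin n → RoundState n → Arc n → RoundState n
scanArc u st a =
  if eqF (tl a) u ∧ improves (rpot st u) (len a) (rpot st (hd a))
  then relaxArc a st else st

scan : ∀ {n} → List (Arc n) → Fin n → RoundState n → RoundState n
scan arcs u (rstate d p dr to sc) =
  foldl (scanArc u) (rstate d p dr (update to u false) (sc ++ (u ∷ []))) arcs

hasRelaxableIn : ∀ {n} → List (Arc n) → (Fin n → Pot) → Fin n → Bool
hasRelaxableIn arcs d v =
  any (λ a → eqF (hd a) v ∧ improves (d (tl a)) (len a) (d v)) arcs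

processList : ∀ {n} → List (Arc n) → List (Fin n) → RoundState n → RoundState n
processList arcs []      st = st
processList arcs (v ∷ L) st =
  if dropped st v ∨ hasRelaxableIn arcs (rpot st) v
  then processList arcs L st
  else processList arcs L (scan arcs v st)

allVertices : ∀ {n} → List (Fin n)
allVertices {n} = Data.List.allFin n
  where import Data.List

runRound : ∀ {n} → List (Arc n) → List (Fin n) → Config n → Config n × List (Fin n)
runRound arcs L (config d p _) =
  let st = processList arcs L (rstate d p (λ _ → false) (λ _ → false) [])
  in config (rpot st) (rparent st)
            (filter (λ v → Data.Bool._≟_ (touched st v) true) allVertices)
     , scanned st
  where import Data.Bool

initial : ∀ {n} → Fin n → Config n
initial s = config (λ v → if eqF v s then just 0ℚ else nothing)
                   (λ _ → nothing)
                   (s ∷ [])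

-- An ordering policy: in round r the set T (given as a list in increasing
-- order) is processed in the order  ord r T.  Rounds on an empty T scan
-- nothing and change nothing (the algorithm has stopped).
Policy : ℕ → Set
Policy n = ℕ → List (Fin n) → List (Fin n)

-- configuration before round r (round 0 is the first round)
configAt : ∀ {n} → List (Arc n) → Fin n → Policy n → ℕ → Config n
configAt arcs s ord zero    = initial s
configAt arcs s ord (suc r) =
  proj₁ (runRound arcs (ord r (T (configAt arcs s ord r))) (configAt arcs s ord r))

scannedIn : ∀ {n} → List (Arc n) → Fin n → Policy n → ℕ → List (Fin n)
scannedIn arcs s ord r =
  proj₂ (runRound arcs (ord r (T (configAt arcs s ord r))) (configAt arcs s ord r))

{-# OPTIONS --safe #-}
-- Call a vertex exact when its potential is its distance from s. Potentials only decrease and always bound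
-- the length of some walk from s, so an exact vertex stays exact; as entering T needs a strict decrease, it
-- is in T in no later round and hence never scanned again. Within a round every exact vertex with a
-- relaxable outgoing arc is touched or still on the list (scanning a vertex leaves none of its arcs
-- relaxable), so at the start of a round all such vertices lie in T. If T is non-empty, pick t in T: either
-- t is exact, or along a shortest walk from s to t (one exists since cycles can be cut out) the potential
-- first exceeds the length walked so far across some arc, whose tail is then exact and has that arc
-- relaxable. Finally, an exact vertex on the list is not skipped: no arc into it is relaxable, and subtree
-- disassembly only drops vertices reachable by a walk shorter than their potential (through the arc just
-- relaxed) or touched later on. So it is scanned in this round, for the last time.
module Submission where

open import Defs
open import Data.Bool using (Bool; true; false; _∨_; _∧_) renaming (_≟_ to _≟ᵇ_)
open import Data.Bool.ListAction using (any)
open import Data.Bool.Properties using (T-≡; ∧-conicalˡ; ∧-conicalʳ; ∨-conicalˡ)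
open import Data.Empty using (⊥-elim)
open import Data.Fin using (Fin)
import Data.Fin.Properties as Fin
open import Data.List using (List; []; _∷_; _++_; foldl; map; length; lookup; filter; cartesianProductWith)
open import Data.List.Properties using (length-map)
import Data.List.Extrema
open import Data.List.Membership.Propositional using (_∈_; _∉_; find)
open import Data.List.Membership.Propositional.Properties
  using (∈-++⁺ˡ; ∈-++⁺ʳ; ∈-++⁻; ∈-lookup; ∈-filter⁺; ∈-filter⁻; ∈-allFin; ∈-cartesianProductWith⁺)
import Data.List.Membership.DecPropositional as DecMembership
open import Data.List.Relation.Binary.Permutation.Propositional using (_↭_; ↭-sym)
open import Data.List.Relation.Binary.Permutation.Propositional.Properties using (∈-resp-↭)
open import Data.List.Relation.Unary.All using (All; []; _∷_; all?; tabulate) renaming (lookup to All-lookup)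
open import Data.List.Relation.Unary.All.Properties using (++⁺; ¬Any⇒All¬; all-filter)
open import Data.List.Relation.Unary.AllPairs using ([]; _∷_)
open import Data.List.Relation.Unary.Any using (here; there)
open import Data.List.Relation.Unary.Any.Properties using (any⁻)
open import Data.List.Relation.Unary.Unique.Propositional using (Unique)
open import Data.Maybe using (Maybe; just; nothing)
open import Data.Nat using (ℕ; zero; suc; s≤s; _≤_; _<_; _≤′_; ≤′-refl; ≤′-step)
open import Data.Nat.Properties using (≤⇒≤′; <⇒≤)
open import Data.Product using (∃; ∃₂; _×_; _,_; proj₁; proj₂)
import Data.Product.Properties as Product
open import Data.Rational using (ℚ; 0ℚ; _+_) renaming (_≤_ to _≤ℚ_; _<_ to _<ℚ_)
import Data.Rational.Properties as ℚ
open import Data.Sum using (_⊎_; inj₁; inj₂; map₂; [_,_])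
open import Function.Bundles using (Equivalence)
open import Relation.Binary.Bundles using (DecTotalOrder)
open import Relation.Binary.PropositionalEquality
  using (_≡_; _≢_; refl; sym; trans; cong; cong₂; subst; subst₂)
open import Relation.Nullary using (¬_; Dec; yes; no; does; contradiction)
open import Relation.Nullary.Decidable using (dec-true; _×-dec_)

module Extrema = Data.List.Extrema (DecTotalOrder.totalOrder ℚ.≤-decTotalOrder)
open Equivalence using (to; from)

+-cancelʳ-≤ℚ : ∀ p q r → p + r ≤ℚ q + r → p ≤ℚ q
+-cancelʳ-≤ℚ p q r p+r≤q+r with p ℚ.≤? q
... | yes p≤q = p≤q
... | no  p≰q = ⊥-elim (ℚ.<-irrefl refl (ℚ.≤-<-trans p+r≤q+r (ℚ.+-monoˡ-< r (ℚ.≰⇒> p≰q))))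

infix 4 _≤∞_ _<∞_

data _≤∞_ : Pot → Pot → Set where
  ≤∞-top    : ∀ {x} → x ≤∞ nothing
  just≤just : ∀ {p q} → p ≤ℚ q → just p ≤∞ just q

data _<∞_ : Pot → Pot → Set where
  <∞-top    : ∀ {p} → just p <∞ nothing
  just<just : ∀ {p q} → p <ℚ q → just p <∞ just q

≤∞-refl : ∀ {x} → x ≤∞ x
≤∞-refl {nothing} = ≤∞-top
≤∞-refl {just p}  = just≤just ℚ.≤-refl

≤∞-trans : ∀ {x y z} → x ≤∞ y → y ≤∞ z → x ≤∞ z
≤∞-trans _             ≤∞-top        = ≤∞-top
≤∞-trans (just≤just p) (just≤just q) = just≤just (ℚ.≤-trans p q)

<∞⇒≤∞ : ∀ {x y} → x <∞ y → x ≤∞ y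
<∞⇒≤∞ <∞-top         = ≤∞-top
<∞⇒≤∞ (just<just p) = just≤just (ℚ.<⇒≤ p)

<∞-≤∞-trans : ∀ {x y z} → x <∞ y → y ≤∞ z → x <∞ z
<∞-≤∞-trans <∞-top        ≤∞-top        = <∞-top
<∞-≤∞-trans (just<just _) ≤∞-top        = <∞-top
<∞-≤∞-trans (just<just p) (just≤just q) = just<just (ℚ.<-≤-trans p q)

≤∞-<∞-trans : ∀ {x y z} → x ≤∞ y → y <∞ z → x <∞ z
≤∞-<∞-trans ≤∞-top        ()
≤∞-<∞-trans (just≤just p) <∞-top        = <∞-top
≤∞-<∞-trans (just≤just p) (just<just q) = just<just (ℚ.≤-<-trans p q)

<∞⇒≱∞ : ∀ {x y} → x <∞ y → ¬ (y ≤∞ x)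
<∞⇒≱∞ <∞-top         ()
<∞⇒≱∞ (just<just p) (just≤just q) = ℚ.<-irrefl refl (ℚ.<-≤-trans p q)

<∞-finite : ∀ {x y} → x <∞ y → ∃ λ p → x ≡ just p
<∞-finite <∞-top        = _ , refl
<∞-finite (just<just _) = _ , refl

≤∞just-finite : ∀ {x q} → x ≤∞ just q → ∃ λ p → x ≡ just p × p ≤ℚ q
≤∞just-finite (just≤just p≤q) = _ , refl , p≤q

≤∞just⊎just<∞ : ∀ x q → x ≤∞ just q ⊎ just q <∞ x
≤∞just⊎just<∞ nothing  q = inj₂ <∞-top
≤∞just⊎just<∞ (just p) q with p ℚ.≤? q
... | yes p≤q = inj₁ (just≤just p≤q)
... | no  p≰q = inj₂ (just<just (ℚ.≰⇒> p≰q))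

does⇒ : ∀ {A : Set} (a? : Dec A) → does a? ≡ true → A
does⇒ (yes a) _ = a

improves⇒<∞ : ∀ {p l} y → improves (just p) l y ≡ true → just (p + l) <∞ y
improves⇒<∞         nothing  _ = <∞-top
improves⇒<∞ {p} {l} (just q) e = just<just (does⇒ (p + l ℚ.<? q) e)

<∞⇒improves : ∀ {p l y} → just (p + l) <∞ y → improves (just p) l y ≡ true
<∞⇒improves                 <∞-top        = refl
<∞⇒improves {p} {l} (just<just {q = q} lt) = dec-true (p + l ℚ.<? q) lt

improves⇒finite : ∀ x {l y} → improves x l y ≡ true → ∃ λ p → x ≡ just p
improves⇒finite nothing  ()
improves⇒finite (just p) _ = p , refl

improves-antitone : ∀ x l {y y′} → y ≤∞ y′ → improves x l y ≡ true → improves x l y′ ≡ true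
improves-antitone x l y≤y′ e with improves⇒finite x e
... | _ , refl = <∞⇒improves (<∞-≤∞-trans (improves⇒<∞ _ e) y≤y′)

improves-≤∞ : ∀ {x c l y} → x ≤∞ just c → just (c + l) <∞ y → improves x l y ≡ true
improves-≤∞ {l = l} (just≤just p≤c) c+l<y =
  <∞⇒improves (≤∞-<∞-trans (just≤just (ℚ.+-monoˡ-≤ l p≤c)) c+l<y)

eqF⇒≡ : ∀ {n} {a b : Fin n} → eqF a b ≡ true → a ≡ b
eqF⇒≡ {a = a} {b} = does⇒ (a Fin.≟ b)

update-same : ∀ {n} {A : Set} (f : Fin n → A) v x → update f v x v ≡ x
update-same f v x rewrite dec-true (v Fin.≟ v) refl = refl

any≡true⇒ : ∀ {A : Set} (p : A → Bool) xs → any p xs ≡ true → ∃ λ x → x ∈ xs × p x ≡ true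
any≡true⇒ p xs e with find (any⁻ p xs (from T-≡ e))
... | x , x∈xs , px = x , x∈xs , to T-≡ px

≢[]⇒∃∈ : ∀ {A : Set} {xs : List A} → xs ≢ [] → ∃ λ x → x ∈ xs
≢[]⇒∃∈ {xs = []}    xs≢[] = ⊥-elim (xs≢[] refl)
≢[]⇒∃∈ {xs = x ∷ _} _     = x , here refl

lookup-injective : ∀ {A : Set} {xs : List A} → Unique xs → ∀ i j → lookup xs i ≡ lookup xs j → i ≡ j
lookup-injective (x∉ ∷ _) Fin.zero    Fin.zero    _ = refl
lookup-injective (x∉ ∷ _) Fin.zero    (Fin.suc j) e = ⊥-elim (All-lookup x∉ (∈-lookup j) e)
lookup-injective (x∉ ∷ _) (Fin.suc i) Fin.zero    e = ⊥-elim (All-lookup x∉ (∈-lookup i) (sym e))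
lookup-injective (_ ∷ u)  (Fin.suc i) (Fin.suc j) e = cong Fin.suc (lookup-injective u i j e)

Unique⇒length≤ : ∀ {n} {xs : List (Fin n)} → Unique xs → length xs ≤ n
Unique⇒length≤ u = Fin.injective⇒≤ (λ {i} {j} → lookup-injective u i j)

walkLength-++ : ∀ {n} (P Q : List (Arc n)) → walkLength (P ++ Q) ≡ walkLength P + walkLength Q
walkLength-++ []      Q = sym (ℚ.+-identityˡ (walkLength Q))
walkLength-++ (a ∷ P) Q =
  trans (cong (len a +_) (walkLength-++ P Q)) (sym (ℚ.+-assoc (len a) (walkLength P) (walkLength Q)))

walkLength-∷ʳ : ∀ {n} (P : List (Arc n)) a → walkLength (P ++ a ∷ []) ≡ walkLength P + len a
walkLength-∷ʳ P a = trans (walkLength-++ P (a ∷ [])) (cong (walkLength P +_) (ℚ.+-identityʳ (len a)))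

walkLength-∷ʳ-≤ : ∀ {n} (P : List (Arc n)) {q} a →
  walkLength P ≤ℚ q → walkLength (P ++ a ∷ []) ≤ℚ q + len a
walkLength-∷ʳ-≤ P a P≤q = subst (_≤ℚ _) (sym (walkLength-∷ʳ P a)) (ℚ.+-monoˡ-≤ (len a) P≤q)

chain-++ : ∀ {n} {u v w : Fin n} {P Q} → Chain u P v → Chain v Q w → Chain u (P ++ Q) w
chain-++ stop         c = c
chain-++ (step a e c) d = step a e (chain-++ c d)

module Walks {n : ℕ} (arcs : List (Arc n)) where

  Walk : Fin n → List (Arc n) → Fin n → Set
  Walk u W v = Chain u W v × All (_∈ arcs) W

  walk-++ : ∀ {u v w P Q} → Walk u P v → Walk v Q w → Walk u (P ++ Q) w
  walk-++ (cP , aP) (cQ , aQ) = chain-++ cP cQ , ++⁺ aP aQ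

  walk-∷ʳ : ∀ {u P a} → Walk u P (tl a) → a ∈ arcs → Walk u (P ++ a ∷ []) (hd a)
  walk-∷ʳ w a∈ = walk-++ w (step _ refl stop , a∈ ∷ [])

  Shortest : Fin n → List (Arc n) → Fin n → Set
  Shortest u M v = Walk u M v × ∀ V → Walk u V v → walkLength M ≤ℚ walkLength V

  shortest-prefix : ∀ {u v w P Q} → Shortest u (P ++ Q) w → Walk u P v → Walk v Q w → Shortest u P v
  shortest-prefix {P = P} {Q} (_ , minimal) wP wQ = wP , λ V wV →
    +-cancelʳ-≤ℚ (walkLength P) (walkLength V) (walkLength Q)
      (subst₂ _≤ℚ_ (walkLength-++ P Q) (walkLength-++ V Q) (minimal (V ++ Q) (walk-++ wV wQ)))

  vertices : Fin n → List (Arc n) → List (Fin n)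
  vertices u W = u ∷ map hd W

  splitAt : ∀ {u w x W} → Walk u W w → Unique (vertices u W) → x ∈ vertices u W →
    ∃₂ λ P Q → W ≡ P ++ Q × Walk u P x × Walk x Q w × Unique (vertices x Q)
  splitAt w uq (here refl) = [] , _ , refl , (stop , []) , w , uq
  splitAt {W = []}    (stop , [])              _        (there ())
  splitAt {W = a ∷ W} (step a refl c , a∈ ∷ as) (_ ∷ uq) (there x∈) with splitAt (c , as) uq x∈
  ... | P , Q , refl , (cP , aP) , wQ , uqQ = a ∷ P , Q , refl , (step a refl cP , a∈ ∷ aP) , wQ , uqQ

  Unique-vertices⇒length< : ∀ {u W} → Unique (vertices u W) → length W < n
  Unique-vertices⇒length< {W = W} uq = subst (_≤ n) (cong suc (length-map hd W)) (Unique⇒length≤ uq)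

  arcLists : ℕ → List (List (Arc n))
  arcLists zero    = [] ∷ []
  arcLists (suc k) = [] ∷ cartesianProductWith _∷_ arcs (arcLists k)

  ∈-arcLists : ∀ {k W} → All (_∈ arcs) W → length W ≤ k → W ∈ arcLists k
  ∈-arcLists {zero}  []         _          = here refl
  ∈-arcLists {suc k} []         _          = here refl
  ∈-arcLists {suc k} (a∈ ∷ as) (s≤s l≤k) =
    there (∈-cartesianProductWith⁺ _∷_ a∈ (∈-arcLists as l≤k))

  walk? : ∀ u v W → Dec (Walk u W v)
  walk? u v W = chain? u W v ×-dec all? (λ a → DecMembership._∈?_ arc≟ a arcs) W
    where
    arc≟ : (a b : Arc n) → Dec (a ≡ b)
    arc≟ = Product.≡-dec Fin._≟_ (Product.≡-dec Fin._≟_ ℚ._≟_)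
    chain? : ∀ u W v → Dec (Chain u W v)
    chain? u [] v with u Fin.≟ v
    ... | yes refl = yes stop
    ... | no  u≢v  = no λ { stop → u≢v refl }
    chain? u (a ∷ W) v with tl a Fin.≟ u | chain? (hd a) W v
    ... | yes refl | yes c  = yes (step a refl c)
    ... | no  t≢u  | _      = no λ { (step _ t≡u _) → t≢u t≡u }
    ... | yes _    | no  ¬c = no λ { (step _ _ c) → ¬c c }

  module _ (noNeg : NoNegativeCycle arcs) where

    loop-nonneg : ∀ {a} → a ∈ arcs → tl a ≡ hd a → 0ℚ ≤ℚ len a
    loop-nonneg {a} a∈ tl≡hd =
      subst (0ℚ ≤ℚ_) (ℚ.+-identityʳ (len a))
        (noNeg (tl a) (a ∷ []) (λ ()) (a∈ ∷ []) (step a refl (subst (Chain _ []) (sym tl≡hd) stop)))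

    -- If the tail of a already lies on the cycle-free walk W′, then a closes a cycle; cutting it off leaves a
    -- cycle-free suffix of W′ that is no longer than a ∷ W′.
    eraseCycles : ∀ {u t W} → Walk u W t →
      ∃ λ W′ → Walk u W′ t × Unique (vertices u W′) × walkLength W′ ≤ℚ walkLength W
    eraseCycles {W = []} (stop , []) = [] , (stop , []) , ([] ∷ []) , ℚ.≤-refl
    eraseCycles {W = a ∷ W} (step a refl c , a∈ ∷ as) with eraseCycles (c , as)
    ... | W′ , w′ , uq , W′≤W with DecMembership._∈?_ Fin._≟_ (tl a) (vertices (hd a) W′)
    ...   | no  tl∉ =
      a ∷ W′ , (step a refl (proj₁ w′) , a∈ ∷ proj₂ w′) , (¬Any⇒All¬ _ tl∉ ∷ uq) ,
      ℚ.+-monoʳ-≤ (len a) W′≤W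
    ...   | yes tl∈ with splitAt w′ uq tl∈
    ...     | P , Q , refl , (cP , aP) , wQ , uqQ = Q , wQ , uqQ , Q≤W
      where
      cycle≥0 : 0ℚ ≤ℚ len a + walkLength P
      cycle≥0 = noNeg (tl a) (a ∷ P) (λ ()) (a∈ ∷ aP) (step a refl cP)
      open ℚ.≤-Reasoning
      Q≤W : walkLength Q ≤ℚ len a + walkLength W
      Q≤W = begin
        walkLength Q                           ≡⟨ ℚ.+-identityˡ (walkLength Q) ⟨
        0ℚ + walkLength Q                      ≤⟨ ℚ.+-monoˡ-≤ (walkLength Q) cycle≥0 ⟩
        (len a + walkLength P) + walkLength Q  ≡⟨ ℚ.+-assoc (len a) (walkLength P) (walkLength Q) ⟩
        len a + (walkLength P + walkLength Q)  ≡⟨ cong (len a +_) (walkLength-++ P Q) ⟨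
        len a + walkLength (P ++ Q)            ≤⟨ ℚ.+-monoʳ-≤ (len a) W′≤W ⟩
        len a + walkLength W                   ∎

    shortestWalk : ∀ {u t W} → Walk u W t → ∃ λ M → Shortest u M t
    shortestWalk {u} {t} w with eraseCycles w
    ... | W′ , wW′ , _ , _ =
      M , Extrema.argmin-all walkLength wW′ (all-filter (walk? u t) (arcLists n)) , minimal
      where
      candidates : List (List (Arc n))
      candidates = filter (walk? u t) (arcLists n)
      M : List (Arc n)
      M = Extrema.argmin walkLength W′ candidates
      minimal : ∀ V → Walk u V t → walkLength M ≤ℚ walkLength V
      minimal V wV with eraseCycles wV
      ... | V′ , wV′ , uq , V′≤V =
        ℚ.≤-trans (All-lookup (Extrema.f[argmin]≤f[xs] _ candidates) V′∈) V′≤V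
        where
        V′∈ : V′ ∈ candidates
        V′∈ = ∈-filter⁺ (walk? u t)
                (∈-arcLists (proj₂ wV′) (<⇒≤ (Unique-vertices⇒length< uq))) wV′

relaxed : ∀ {n} → RoundState n → Arc n → ℚ → RoundState n
relaxed st a q = rstate (update (rpot st) (hd a) (just (q + len a)))
                        (update (rparent st) (hd a) (just (tl a)))
                        (λ w → dropped st w ∨ inSubtree (rparent st) (hd a) w)
                        (update (touched st) (hd a) true)
                        (scanned st)

relaxArc≡relaxed : ∀ {n} (a : Arc n) st {q} → rpot st (tl a) ≡ just q → relaxArc a st ≡ relaxed st a q
relaxArc≡relaxed a st eq with rpot st (tl a)
relaxArc≡relaxed a st refl | just _ = refl

scanned-relaxArc : ∀ {n} (a : Arc n) st → scanned (relaxArc a st) ≡ scanned st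
scanned-relaxArc a st with rpot st (tl a)
... | nothing = refl
... | just _  = refl

scanned-scanArc : ∀ {n} v st (a : Arc n) → scanned (scanArc v st a) ≡ scanned st
scanned-scanArc v st a with eqF (tl a) v ∧ improves (rpot st v) (len a) (rpot st (hd a))
... | true  = scanned-relaxArc a st
... | false = refl

scanned-scan : ∀ {n} arcs v (st : RoundState n) → scanned (scan arcs v st) ≡ scanned st ++ v ∷ []
scanned-scan arcs v st = go arcs _
  where
  go : ∀ R st′ → scanned (foldl (scanArc v) st′ R) ≡ scanned st′
  go []      st′ = refl
  go (a ∷ R) st′ = trans (go R (scanArc v st′ a)) (scanned-scanArc v st′ a)

∈-scanned-scan : ∀ {n} arcs v (st : RoundState n) → v ∈ scanned (scan arcs v st)
∈-scanned-scan arcs v st = subst (v ∈_) (sym (scanned-scan arcs v st)) (∈-++⁺ʳ (scanned st) (here refl))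

module _ {n} (arcs : List (Arc n)) where

  processList-scanned-mono : ∀ L st {x} → x ∈ scanned st → x ∈ scanned (processList arcs L st)
  processList-scanned-mono []      st x∈ = x∈
  processList-scanned-mono (v ∷ L) st x∈ with dropped st v ∨ hasRelaxableIn arcs (rpot st) v
  ... | true  = processList-scanned-mono L st x∈
  ... | false = processList-scanned-mono L (scan arcs v st)
                  (subst (_ ∈_) (sym (scanned-scan arcs v st)) (∈-++⁺ˡ x∈))

  processList-scanned⊆ : ∀ L st {x} → x ∈ scanned (processList arcs L st) → x ∈ scanned st ⊎ x ∈ L
  processList-scanned⊆ []      st x∈ = inj₁ x∈
  processList-scanned⊆ (v ∷ L) st x∈ with dropped st v ∨ hasRelaxableIn arcs (rpot st) v
  ... | true = map₂ there (processList-scanned⊆ L st x∈)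
  ... | false with processList-scanned⊆ L (scan arcs v st) x∈
  ...   | inj₂ x∈L = inj₂ (there x∈L)
  ...   | inj₁ x∈′ with ∈-++⁻ (scanned st) (subst (_ ∈_) (scanned-scan arcs v st) x∈′)
  ...     | inj₁ x∈st        = inj₁ x∈st
  ...     | inj₂ (here refl) = inj₂ (here refl)

module Algorithm {n : ℕ} (arcs : List (Arc n)) (s : Fin n) (noNeg : NoNegativeCycle arcs) where

  open Walks arcs

  LowerBound : Fin n → ℚ → Set
  LowerBound x q = ∀ W → Walk s W x → q ≤ℚ walkLength W

  Exact : (Fin n → Pot) → Fin n → Set
  Exact d x = ∃ λ q → d x ≡ just q × LowerBound x q

  Witnessed : (Fin n → Pot) → Set
  Witnessed d = ∀ {x q} → d x ≡ just q → ∃ λ W → Walk s W x × walkLength W ≤ℚ q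

  HasShorterWalk : (Fin n → Pot) → Fin n → Set
  HasShorterWalk d x = ∃ λ W → Walk s W x × just (walkLength W) <∞ d x

  Relaxable : (Fin n → Pot) → Arc n → Set
  Relaxable d a = improves (d (tl a)) (len a) (d (hd a)) ≡ true

  ExactRelaxable : (Fin n → Pot) → Fin n → Arc n → Set
  ExactRelaxable d x a = a ∈ arcs × tl a ≡ x × Relaxable d a × Exact d x

  ParentArcs : (Fin n → Pot) → (Fin n → Maybe (Fin n)) → Set
  ParentArcs d p = ∀ {w u} → p w ≡ just u →
    ∃ λ a → a ∈ arcs × tl a ≡ u × hd a ≡ w × ∃ λ q → d u ≡ just q × just (q + len a) ≤∞ d w

  relaxable⇒<∞ : ∀ {d a p} → Relaxable d a → d (tl a) ≡ just p → just (p + len a) <∞ d (hd a)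
  relaxable⇒<∞ {d} {a} rel dtl =
    improves⇒<∞ _ (subst (λ x → improves x (len a) (d (hd a)) ≡ true) dtl rel)

  lowerBound-≤∞ : ∀ {d x q} → Witnessed d → LowerBound x q → just q ≤∞ d x
  lowerBound-≤∞ {d} {x} witnessed lb with d x in dx
  ... | nothing = ≤∞-top
  ... | just p with witnessed dx
  ...   | W , w , W≤p = just≤just (ℚ.≤-trans (lb W w) W≤p)

  lowerBound-¬shorter : ∀ {d x q} → LowerBound x q → d x ≤∞ just q → ¬ HasShorterWalk d x
  lowerBound-¬shorter lb dx≤q (W , w , W<dx) = <∞⇒≱∞ (<∞-≤∞-trans W<dx dx≤q) (just≤just (lb W w))

  relaxable⇒shorterWalk : ∀ {d b} → Witnessed d → b ∈ arcs → Relaxable d b → HasShorterWalk d (hd b)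
  relaxable⇒shorterWalk {d} {b} witnessed b∈ rel with improves⇒finite (d (tl b)) rel
  ... | p , dtl with witnessed dtl
  ...   | W , w , W≤p = W ++ b ∷ [] , walk-∷ʳ w b∈ ,
    ≤∞-<∞-trans (just≤just (walkLength-∷ʳ-≤ W b W≤p)) (relaxable⇒<∞ {d} rel dtl)

  shortest⇒exact : ∀ {d y P} → Shortest s P y → d y ≤∞ just (walkLength P) → Exact d y
  shortest⇒exact (_ , minimal) dy≤P with ≤∞just-finite dy≤P
  ... | q , dy , q≤P = q , dy , λ V wV → ℚ.≤-trans q≤P (minimal V wV)

  relaxableOnWalk : ∀ d {z t W} c → Walk z W t → d z ≤∞ just c → just (c + walkLength W) <∞ d t →
    ∃ λ y → ∃₂ λ P R → W ≡ P ++ R × Walk z P y × Walk y R t × d y ≤∞ just (c + walkLength P) ×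
      ∃ λ a → a ∈ arcs × tl a ≡ y × Relaxable d a
  relaxableOnWalk d c (stop , []) dz≤c c<dt =
    ⊥-elim (<∞⇒≱∞ (subst (λ r → just r <∞ _) (ℚ.+-identityʳ c) c<dt) dz≤c)
  relaxableOnWalk d c (step b refl cW , b∈ ∷ as) dz≤c c<dt with ≤∞just⊎just<∞ (d (hd b)) (c + len b)
  ... | inj₂ c+b<d = _ , [] , _ , refl , (stop , []) , (step b refl cW , b∈ ∷ as) ,
                     subst (λ r → d (tl b) ≤∞ just r) (sym (ℚ.+-identityʳ c)) dz≤c ,
                     b , b∈ , refl , improves-≤∞ dz≤c c+b<d
  ... | inj₁ d≤c+b with relaxableOnWalk d (c + len b) (cW , as) d≤c+b
                          (subst (λ r → just r <∞ _) (sym (ℚ.+-assoc c (len b) _)) c<dt)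
  ...   | y , P , R , refl , (cP , aP) , wR , dy≤ , arc =
    y , b ∷ P , R , refl , (step b refl cP , b∈ ∷ aP) , wR ,
    subst (λ r → d y ≤∞ just r) (ℚ.+-assoc c (len b) (walkLength P)) dy≤ , arc

  exact⊎exactRelaxable : ∀ {d t q} → Witnessed d → d s ≤∞ just 0ℚ → d t ≡ just q →
    Exact d t ⊎ ∃₂ λ y a → ExactRelaxable d y a
  exact⊎exactRelaxable {d} {t} {q} witnessed s≤0 dt with witnessed dt
  ... | W , wW , _ with shortestWalk noNeg wW
  ...   | M , shortestM with q ℚ.≤? walkLength M
  ...     | yes q≤M =
    inj₁ (shortest⇒exact {d} shortestM (subst (_≤∞ just (walkLength M)) (sym dt) (just≤just q≤M)))
  ...     | no  q≰M with relaxableOnWalk d 0ℚ (proj₁ shortestM) s≤0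
                           (subst (_ <∞_) (sym dt)
                             (just<just (subst (_<ℚ q) (sym (ℚ.+-identityˡ _)) (ℚ.≰⇒> q≰M))))
  ...       | y , P , R , refl , wP , wR , dy≤P , a , a∈ , refl , rel = inj₂ (y , a , a∈ , refl , rel , exact)
    where
    exact : Exact d y
    exact = shortest⇒exact {d} (shortest-prefix shortestM wP wR)
                               (subst (λ r → d y ≤∞ just r) (ℚ.+-identityˡ (walkLength P)) dy≤P)

  subtree⇒parentWalk : ∀ {d p} → ParentArcs d p → ∀ k {v w} → inSubtreeWithin k p v w ≡ true →
    w ≡ v ⊎ ∃ λ C → Walk v C w × ∃ λ q → d v ≡ just q × just (q + walkLength C) ≤∞ d w
  subtree⇒parentWalk parentArcs zero e = inj₁ (eqF⇒≡ e)
  subtree⇒parentWalk {d} {p} parentArcs (suc k) {v} {w} e with eqF w v in w≡v | p w in pw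
  ... | true  | _       = inj₁ (eqF⇒≡ w≡v)
  ... | false | just x  with parentArcs pw | subtree⇒parentWalk parentArcs k e
  ...   | b , b∈ , refl , refl , qx , dx , qx+b≤dw | inj₁ refl =
    inj₂ (b ∷ [] , (step b refl stop , b∈ ∷ []) , qx , dx ,
          subst (λ r → just (qx + r) ≤∞ d w) (sym (ℚ.+-identityʳ (len b))) qx+b≤dw)
  ...   | b , b∈ , refl , refl , qx , dx , qx+b≤dw | inj₂ (C , wC , qv , dv , v+C≤dx)
    with ≤∞just-finite (subst (λ y → just (qv + walkLength C) ≤∞ y) dx v+C≤dx)
  ...     | _ , refl , v+C≤qx =
    inj₂ (C ++ b ∷ [] , walk-∷ʳ wC b∈ , qv , dv , ≤∞-trans (just≤just v+C+b≤qx+b) qx+b≤dw)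
    where
    v+C+b≤qx+b : qv + walkLength (C ++ b ∷ []) ≤ℚ qx + len b
    v+C+b≤qx+b = subst (_≤ℚ qx + len b)
      (trans (ℚ.+-assoc qv (walkLength C) (len b)) (cong (qv +_) (sym (walkLength-∷ʳ C b))))
      (ℚ.+-monoˡ-≤ (len b) v+C≤qx)

  record RoundInvariant (d₀ : Fin n → Pot) (st : RoundState n) : Set where
    field
      witnessed         : Witnessed (rpot st)
      parentArcs        : ParentArcs (rpot st) (rparent st)
      ≤start            : ∀ w → rpot st w ≤∞ d₀ w
      touched⇒<start    : ∀ {w} → touched st w ≡ true → rpot st w <∞ d₀ w
      dropped⇒shorter⊎touched : ∀ {w} → dropped st w ≡ true →
                                HasShorterWalk (rpot st) w ⊎ touched st w ≡ true

  module Relaxation {d₀ st a q} (inv : RoundInvariant d₀ st) (a∈ : a ∈ arcs)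
                    (dtl : rpot st (tl a) ≡ just q) (improving : just (q + len a) <∞ rpot st (hd a)) where

    open RoundInvariant inv

    st′ : RoundState n
    st′ = relaxed st a q

    tl≢hd : tl a ≢ hd a
    tl≢hd tl≡hd with subst (λ y → just (q + len a) <∞ rpot st y) (sym tl≡hd) improving
    ... | q+a<dtl with subst (just (q + len a) <∞_) dtl q+a<dtl
    ...   | just<just q+a<q = ℚ.<-irrefl refl (ℚ.≤-<-trans q≤q+a q+a<q)
      where
      q≤q+a : q ≤ℚ q + len a
      q≤q+a = subst (_≤ℚ q + len a) (ℚ.+-identityʳ q) (ℚ.+-monoʳ-≤ q (loop-nonneg noNeg a∈ tl≡hd))

    pot-head : rpot st′ (hd a) ≡ just (q + len a)
    pot-head = update-same (rpot st) (hd a) _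

    pot-other : ∀ {w} → w ≢ hd a → rpot st′ w ≡ rpot st w
    pot-other {w} w≢hd with w Fin.≟ hd a
    ... | yes w≡hd = ⊥-elim (w≢hd w≡hd)
    ... | no  _    = refl

    pot-decreased : ∀ w → rpot st′ w ≤∞ rpot st w
    pot-decreased w with w Fin.≟ hd a
    ... | yes refl = <∞⇒≤∞ improving
    ... | no  _    = ≤∞-refl

    ¬relaxable : ¬ Relaxable (rpot st′) a
    ¬relaxable rel
      with subst (just (q + len a) <∞_) pot-head (relaxable⇒<∞ {rpot st′} rel (trans (pot-other tl≢hd) dtl))
    ... | just<just q+a<q+a = ℚ.<-irrefl refl q+a<q+a

    exactRelaxable-before : ∀ {x b} → ExactRelaxable (rpot st′) x b →
                            x ≡ hd a ⊎ ExactRelaxable (rpot st) x b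
    exactRelaxable-before {x} {b} (b∈ , refl , rel , exact) with x Fin.≟ hd a
    ... | yes x≡hd = inj₁ x≡hd
    ... | no  _    = inj₂ (b∈ , refl , improves-antitone (rpot st x) (len b) (pot-decreased (hd b)) rel , exact)

    touched-preserved : ∀ {w} → touched st w ≡ true → touched st′ w ≡ true
    touched-preserved {w} tw with w Fin.≟ hd a
    ... | yes _ = refl
    ... | no  _ = tw

    invariant : RoundInvariant d₀ st′
    invariant = record
      { witnessed = witnessed′ ; parentArcs = parentArcs′
      ; ≤start = λ w → ≤∞-trans (pot-decreased w) (≤start w)
      ; touched⇒<start = touched⇒<start′
      ; dropped⇒shorter⊎touched = dropped⇒shorter⊎touched′ }
      where
      witnessed′ : Witnessed (rpot st′)
      witnessed′ {x} dx with x Fin.≟ hd a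
      ... | no _ = witnessed dx
      ... | yes refl with witnessed dtl | dx
      ...   | W , w , W≤q | refl = W ++ a ∷ [] , walk-∷ʳ w a∈ , walkLength-∷ʳ-≤ W a W≤q

      parentArcs′ : ParentArcs (rpot st′) (rparent st′)
      parentArcs′ {w} pw with w Fin.≟ hd a | pw
      ... | yes refl | refl = a , a∈ , refl , refl , q , trans (pot-other tl≢hd) dtl , ≤∞-refl
      ... | no w≢hd  | pw′ with parentArcs pw′
      ...   | b , b∈ , refl , refl , qu , du , u+b≤w with tl b Fin.≟ hd a
      ...     | no _ = b , b∈ , refl , refl , qu , du , u+b≤w
      ...     | yes refl with subst (just (q + len a) <∞_) du improving
      ...       | just<just lt = b , b∈ , refl , refl , q + len a , refl ,
                  ≤∞-trans (just≤just (ℚ.+-monoˡ-≤ (len b) (ℚ.<⇒≤ lt))) u+b≤w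

      touched⇒<start′ : ∀ {w} → touched st′ w ≡ true → rpot st′ w <∞ d₀ w
      touched⇒<start′ {w} tw with w Fin.≟ hd a
      ... | yes refl = <∞-≤∞-trans improving (≤start (hd a))
      ... | no  _    = touched⇒<start tw

      -- A vertex below hd a in the parent tree now has a walk through a shorter than its potential.
      dropped⇒shorter⊎touched′ : ∀ {w} → dropped st′ w ≡ true →
                                 HasShorterWalk (rpot st′) w ⊎ touched st′ w ≡ true
      dropped⇒shorter⊎touched′ {w} dw with w Fin.≟ hd a
      ... | yes refl = inj₂ refl
      ... | no w≢hd with dropped st w in dw₀
      ...   | true = dropped⇒shorter⊎touched dw₀
      ...   | false with subtree⇒parentWalk parentArcs n dw
      ...     | inj₁ w≡hd = ⊥-elim (w≢hd w≡hd)
      ...     | inj₂ (C , wC , qv , dv , v+C≤w) with witnessed dtl | subst (just (q + len a) <∞_) dv improving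
      ...       | W , wW , W≤q | just<just a<v =
        inj₁ (W ++ a ∷ C , walk-++ wW (step a refl (proj₁ wC) , a∈ ∷ proj₂ wC) ,
              <∞-≤∞-trans (just<just shorter) v+C≤w)
        where
        open ℚ.≤-Reasoning
        shorter : walkLength (W ++ a ∷ C) <ℚ qv + walkLength C
        shorter = begin-strict
          walkLength (W ++ a ∷ C)                ≡⟨ walkLength-++ W (a ∷ C) ⟩
          walkLength W + (len a + walkLength C)  ≡⟨ ℚ.+-assoc (walkLength W) (len a) (walkLength C) ⟨
          (walkLength W + len a) + walkLength C  ≤⟨ ℚ.+-monoˡ-≤ _ (ℚ.+-monoˡ-≤ _ W≤q) ⟩
          (q + len a) + walkLength C             <⟨ ℚ.+-monoˡ-< (walkLength C) a<v ⟩
          qv + walkLength C                      ∎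

  Covered : List (Fin n) → RoundState n → Set
  Covered L st = ∀ {x a} → ExactRelaxable (rpot st) x a → touched st x ≡ true ⊎ x ∈ L

  CoveredWhileScanning : Fin n → List (Fin n) → List (Arc n) → RoundState n → Set
  CoveredWhileScanning v L R st =
    ∀ {x a} → ExactRelaxable (rpot st) x a → touched st x ≡ true ⊎ x ∈ L ⊎ (x ≡ v × a ∈ R)

  scanArc-preserves : ∀ {d₀ v L a R st} → a ∈ arcs →
    RoundInvariant d₀ st → CoveredWhileScanning v L (a ∷ R) st →
    RoundInvariant d₀ (scanArc v st a) × CoveredWhileScanning v L R (scanArc v st a)
  scanArc-preserves {v = v} {L} {a} {R} {st} a∈ inv covered
    with eqF (tl a) v ∧ improves (rpot st v) (len a) (rpot st (hd a)) in cond
  ... | false = inv , covered′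
    where
    covered′ : CoveredWhileScanning v L R st
    covered′ {x} {b} er with covered er
    ... | inj₁ t                        = inj₁ t
    ... | inj₂ (inj₁ x∈L)               = inj₂ (inj₁ x∈L)
    ... | inj₂ (inj₂ (x≡v , there b∈R)) = inj₂ (inj₂ (x≡v , b∈R))
    ... | inj₂ (inj₂ (refl , here refl)) with er
    ...   | _ , refl , rel , _ =
      contradiction (trans (sym cond) (cong₂ _∧_ (dec-true (tl a Fin.≟ tl a) refl) rel)) λ ()
  ... | true with eqF⇒≡ {a = tl a} {v} (∧-conicalˡ _ _ cond)
  ...   | refl with improves⇒finite (rpot st (tl a)) (∧-conicalʳ (eqF (tl a) v) _ cond)
  ...     | q , dtl rewrite relaxArc≡relaxed a st dtl = invariant , covered′
    where
    open Relaxation inv a∈ dtl (relaxable⇒<∞ {rpot st} (∧-conicalʳ (eqF (tl a) (tl a)) _ cond) dtl)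
    covered′ : CoveredWhileScanning (tl a) L R st′
    covered′ er with exactRelaxable-before er
    ... | inj₁ refl = inj₁ (update-same (touched st) (hd a) true)
    ... | inj₂ er₀ with covered er₀
    ...   | inj₁ t                        = inj₁ (touched-preserved t)
    ...   | inj₂ (inj₁ x∈L)               = inj₂ (inj₁ x∈L)
    ...   | inj₂ (inj₂ (x≡v , there b∈R)) = inj₂ (inj₂ (x≡v , b∈R))
    ...   | inj₂ (inj₂ (_ , here refl))   = ⊥-elim (¬relaxable (proj₁ (proj₂ (proj₂ er))))

  scanArcs-preserves : ∀ {d₀ v L} R {st} → All (_∈ arcs) R →
    RoundInvariant d₀ st → CoveredWhileScanning v L R st →
    RoundInvariant d₀ (foldl (scanArc v) st R) × CoveredWhileScanning v L [] (foldl (scanArc v) st R)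
  scanArcs-preserves []      _          inv covered = inv , covered
  scanArcs-preserves (a ∷ R) (a∈ ∷ R⊆) inv covered with scanArc-preserves a∈ inv covered
  ... | inv′ , covered′ = scanArcs-preserves R R⊆ inv′ covered′

  scan-preserves : ∀ {d₀ v L st} → dropped st v ≡ false →
    RoundInvariant d₀ st → Covered (v ∷ L) st →
    RoundInvariant d₀ (scan arcs v st) × Covered L (scan arcs v st)
  scan-preserves {d₀} {v} {L} {st} dv inv covered
    with scanArcs-preserves arcs (tabulate (λ a∈ → a∈)) inv₁ covered₁
    where
    open RoundInvariant inv
    st₁ : RoundState n
    st₁ = rstate (rpot st) (rparent st) (dropped st) (update (touched st) v false) (scanned st ++ v ∷ [])
    touched₁ : ∀ {w} → touched st₁ w ≡ true → rpot st w <∞ d₀ w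
    touched₁ {w} tw with w Fin.≟ v
    touched₁ {w} () | yes _
    touched₁ {w} tw | no  _ = touched⇒<start tw
    dropped₁ : ∀ {w} → dropped st w ≡ true → HasShorterWalk (rpot st) w ⊎ touched st₁ w ≡ true
    dropped₁ {w} dw with w Fin.≟ v | dropped⇒shorter⊎touched dw
    ... | _        | inj₁ shorter = inj₁ shorter
    ... | no _     | inj₂ tw      = inj₂ tw
    ... | yes refl | inj₂ _       = contradiction (trans (sym dv) dw) λ ()
    inv₁ : RoundInvariant d₀ st₁
    inv₁ = record { witnessed = witnessed ; parentArcs = parentArcs ; ≤start = ≤start
                  ; touched⇒<start = touched₁ ; dropped⇒shorter⊎touched = dropped₁ }
    covered₁ : CoveredWhileScanning v L arcs st₁
    covered₁ {x} er with x Fin.≟ v | covered er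
    ... | yes x≡v | _                = inj₂ (inj₂ (x≡v , proj₁ er))
    ... | no _    | inj₁ tx          = inj₁ tx
    ... | no x≢v  | inj₂ (here x≡v)  = ⊥-elim (x≢v x≡v)
    ... | no _    | inj₂ (there x∈L) = inj₂ (inj₁ x∈L)
  ... | inv′ , covered′ = inv′ , λ er → map₂ [ (λ x∈L → x∈L) , (λ { (_ , ()) }) ] (covered′ er)

  Skipped : RoundState n → Fin n → Set
  Skipped st v = (dropped st v ∨ hasRelaxableIn arcs (rpot st) v) ≡ true

  skipped⇒touched : ∀ {d₀ st v q} → RoundInvariant d₀ st → LowerBound v q → rpot st v ≤∞ just q →
    Skipped st v → touched st v ≡ true
  skipped⇒touched {st = st} {v} inv lb v≤q skip with dropped st v in dv
  ... | true with RoundInvariant.dropped⇒shorter⊎touched inv dv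
  ...   | inj₁ shorter = ⊥-elim (lowerBound-¬shorter {rpot st} lb v≤q shorter)
  ...   | inj₂ tv      = tv
  skipped⇒touched {st = st} {v} inv lb v≤q skip | false
    with any≡true⇒ (λ a → eqF (hd a) v ∧ improves (rpot st (tl a)) (len a) (rpot st v)) arcs skip
  ... | b , b∈ , into-v with eqF⇒≡ {a = hd b} {v} (∧-conicalˡ _ _ into-v)
  ...   | refl =
    ⊥-elim (lowerBound-¬shorter {rpot st} lb v≤q (relaxable⇒shorterWalk {rpot st} witnessed b∈ rel))
    where
    open RoundInvariant inv
    rel : Relaxable (rpot st) b
    rel = ∧-conicalʳ (eqF (hd b) (hd b)) _ into-v

  exact⇒¬skipped : ∀ {d₀ st v} → RoundInvariant d₀ st → Exact d₀ v → ¬ Skipped st v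
  exact⇒¬skipped {v = v} inv (q , dv , lb) skip =
    <∞⇒≱∞ (subst (_ <∞_) dv (touched⇒<start tv)) (lowerBound-≤∞ witnessed lb)
    where
    open RoundInvariant inv
    tv = skipped⇒touched inv lb (subst (_ ≤∞_) dv (≤start v)) skip

  skip-preserves : ∀ {d₀ v L st} → RoundInvariant d₀ st → Covered (v ∷ L) st → Skipped st v →
    Covered L st
  skip-preserves inv covered skip er@(_ , _ , _ , q , dx , lb) with covered er
  ... | inj₁ tx          = inj₁ tx
  ... | inj₂ (there x∈L) = inj₂ x∈L
  ... | inj₂ (here refl) = inj₁ (skipped⇒touched inv lb (subst (_≤∞ just q) (sym dx) ≤∞-refl) skip)

  processList-preserves : ∀ L {d₀ st} → RoundInvariant d₀ st → Covered L st →
    RoundInvariant d₀ (processList arcs L st) × Covered [] (processList arcs L st)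
  processList-preserves []      inv covered = inv , covered
  processList-preserves (v ∷ L) {st = st} inv covered
    with dropped st v ∨ hasRelaxableIn arcs (rpot st) v in skip
  ... | true  = processList-preserves L inv (skip-preserves inv covered skip)
  ... | false with scan-preserves (∨-conicalˡ _ _ skip) inv covered
  ...   | inv′ , covered′ = processList-preserves L inv′ covered′

  processList-scans-exact : ∀ L {d₀ st x} → RoundInvariant d₀ st → Covered L st →
    x ∈ L → Exact d₀ x → x ∈ scanned (processList arcs L st)
  processList-scans-exact (v ∷ L) {st = st} inv covered x∈ exact
    with dropped st v ∨ hasRelaxableIn arcs (rpot st) v in skip | x∈
  ... | true  | here refl = ⊥-elim (exact⇒¬skipped inv exact skip)
  ... | true  | there x∈L = processList-scans-exact L inv (skip-preserves inv covered skip) x∈L exact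
  ... | false | here refl = processList-scanned-mono arcs L (scan arcs v st) (∈-scanned-scan arcs v st)
  ... | false | there x∈L with scan-preserves (∨-conicalˡ _ _ skip) inv covered
  ...   | inv′ , covered′ = processList-scans-exact L inv′ covered′ x∈L exact

  startState : Config n → RoundState n
  startState c = rstate (pot c) (parent c) (λ _ → false) (λ _ → false) []

  endState : List (Fin n) → Config n → RoundState n
  endState L c = processList arcs L (startState c)

  record Invariant (c : Config n) : Set where
    field
      witnessed         : Witnessed (pot c)
      parentArcs        : ParentArcs (pot c) (parent c)
      source≤0          : pot c s ≤∞ just 0ℚ
      T-finite          : ∀ {x} → x ∈ T c → ∃ λ q → pot c x ≡ just q
      exactRelaxable⇒∈T : ∀ {x a} → ExactRelaxable (pot c) x a → x ∈ T c

  initial-invariant : Invariant (initial s)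
  initial-invariant = record
    { witnessed = witnessed₀ ; parentArcs = λ () ; source≤0 = subst (_≤∞ just 0ℚ) (sym pot-s) ≤∞-refl
    ; T-finite = λ { (here refl) → 0ℚ , pot-s } ; exactRelaxable⇒∈T = ∈T₀ }
    where
    pot-s : pot (initial s) s ≡ just 0ℚ
    pot-s rewrite dec-true (s Fin.≟ s) refl = refl
    witnessed₀ : Witnessed (pot (initial s))
    witnessed₀ {x} dx with x Fin.≟ s | dx
    ... | yes refl | refl = [] , (stop , []) , ℚ.≤-refl
    ∈T₀ : ∀ {x a} → ExactRelaxable (pot (initial s)) x a → x ∈ T (initial s)
    ∈T₀ {a = a} (_ , refl , rel , _) with tl a Fin.≟ s | rel
    ... | yes tl≡s | _ = here tl≡s

  module _ {c : Config n} {L : List (Fin n)} (inv : Invariant c) (L↭T : L ↭ T c) where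

    open Invariant inv

    private
      c′ : Config n
      c′ = proj₁ (runRound arcs L c)

      start-invariant : RoundInvariant (pot c) (startState c)
      start-invariant = record
        { witnessed = witnessed ; parentArcs = parentArcs ; ≤start = λ _ → ≤∞-refl
        ; touched⇒<start = λ () ; dropped⇒shorter⊎touched = λ () }

      start-covered : Covered L (startState c)
      start-covered er = inj₂ (∈-resp-↭ (↭-sym L↭T) (exactRelaxable⇒∈T er))

      end-invariant : RoundInvariant (pot c) (endState L c) × Covered [] (endState L c)
      end-invariant = processList-preserves L start-invariant start-covered

      open RoundInvariant (proj₁ end-invariant)
        renaming (witnessed to witnessed′; parentArcs to parentArcs′)

      touched? = λ v → touched (endState L c) v ≟ᵇ true

    runRound-≤ : ∀ x → pot c′ x ≤∞ pot c x
    runRound-≤ = ≤start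

    runRound-T-< : ∀ {x} → x ∈ T c′ → pot c′ x <∞ pot c x
    runRound-T-< x∈T = touched⇒<start (proj₂ (∈-filter⁻ touched? {xs = allVertices} x∈T))

    runRound-invariant : Invariant c′
    runRound-invariant = record
      { witnessed = witnessed′ ; parentArcs = parentArcs′ ; source≤0 = ≤∞-trans (≤start s) source≤0
      ; T-finite = λ x∈T → <∞-finite (runRound-T-< x∈T)
      ; exactRelaxable⇒∈T = λ er → ∈T (proj₂ end-invariant er) }
      where
      ∈T : ∀ {x} → touched (endState L c) x ≡ true ⊎ x ∈ [] → x ∈ T c′
      ∈T (inj₁ tx) = ∈-filter⁺ touched? (∈-allFin _) tx

    runRound-scans-exact : ∀ {x} → x ∈ L → Exact (pot c) x → x ∈ proj₂ (runRound arcs L c)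
    runRound-scans-exact = processList-scans-exact L start-invariant start-covered

  runRound-scanned⊆ : ∀ L c {x} → x ∈ proj₂ (runRound arcs L c) → x ∈ L
  runRound-scanned⊆ L c x∈ with processList-scanned⊆ arcs L (startState c) x∈
  ... | inj₂ x∈L = x∈L

  exactVertexInT : ∀ {c} → Invariant c → T c ≢ [] → ∃ λ x → x ∈ T c × Exact (pot c) x
  exactVertexInT {c} inv T≢[] with ≢[]⇒∃∈ T≢[]
  ... | t , t∈T with Invariant.T-finite inv t∈T
  ...   | _ , dt with exact⊎exactRelaxable (Invariant.witnessed inv) (Invariant.source≤0 inv) dt
  ...     | inj₁ exact                  = t , t∈T , exact
  ...     | inj₂ (y , a , er@(_ , _ , _ , exact)) = y , Invariant.exactRelaxable⇒∈T inv er , exact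

  module Run (ord : Policy n) (ord↭ : ∀ r L → ord r L ↭ L) where

    cfg : ℕ → Config n
    cfg = configAt arcs s ord

    invariant : ∀ r → Invariant (cfg r)
    invariant zero    = initial-invariant
    invariant (suc r) = runRound-invariant (invariant r) (ord↭ r _)

    pot-antitone : ∀ {r r′ x} → r ≤′ r′ → pot (cfg r′) x ≤∞ pot (cfg r) x
    pot-antitone ≤′-refl = ≤∞-refl
    pot-antitone {x = x} (≤′-step {r′} r≤r′) =
      ≤∞-trans (runRound-≤ (invariant r′) (ord↭ r′ _) x) (pot-antitone r≤r′)

    exact⇒∉T : ∀ {r r′ x} → Exact (pot (cfg r)) x → r < r′ → x ∉ T (cfg r′)
    exact⇒∉T {r} {suc r′} (q , dx , lb) (s≤s r≤r′) x∈T =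
      <∞⇒≱∞ (<∞-≤∞-trans (runRound-T-< (invariant r′) (ord↭ r′ _) x∈T)
                          (subst (_ ≤∞_) dx (pot-antitone (≤⇒≤′ r≤r′))))
            (lowerBound-≤∞ (Invariant.witnessed (invariant (suc r′))) lb)

    scanned⇒∈T : ∀ r {x} → x ∈ scannedIn arcs s ord r → x ∈ T (cfg r)
    scanned⇒∈T r x∈ = ∈-resp-↭ (ord↭ r _) (runRound-scanned⊆ (ord r (T (cfg r))) (cfg r) x∈)

    exact∈T⇒scanned : ∀ r {x} → x ∈ T (cfg r) → Exact (pot (cfg r)) x → x ∈ scannedIn arcs s ord r
    exact∈T⇒scanned r x∈T =
      runRound-scans-exact (invariant r) (ord↭ r _) (∈-resp-↭ (↭-sym (ord↭ r _)) x∈T)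

mainTheorem2 : ∀ (n : ℕ) (arcs : List (Arc n)) (s : Fin n) →
    NoNegativeCycle arcs →
    (ord : Policy n) → (∀ r L → ord r L ↭ L) →
    ∀ (r : ℕ) → T (configAt arcs s ord r) ≢ [] →
    ∃ λ v → v ∈ scannedIn arcs s ord r ×
      (∀ r′ → r < r′ → v ∉ scannedIn arcs s ord r′)
mainTheorem2 n arcs s noNeg ord ord↭ r T≢[] =
  let v , v∈T , exact = exactVertexInT (invariant r) T≢[]
  in v , exact∈T⇒scanned r v∈T exact ,
     λ r′ r<r′ v∈ → exact⇒∉T exact r<r′ (scanned⇒∈T r′ v∈)
  where
  open Algorithm arcs s noNeg
  open Run ord ord↭
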